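{- If $G$ is a finite simple graph which is both $(P_3\cup P_2)$-free and $HVN$-free with $\omega(G)\geq 4$, then $\chi(G)\leq\omega(G)+1$.
   Context: All graphs are finite, simple, undirected. $\omega$ is the clique number and $\chi$ the chromatic number. $P_3\cup P_2$ is the disjoint union of a path on 3 vertices and a path on 2 vertices. $HVN$ is the graph $(K_1\cup K_2)+K_2$, i.e. a $K_4$ together with one extra vertex adjacent to exactly two vertices of the $K_4$. A graph is $H$-free if it has no induced subgraph isomorphic to $H$. -}

module Defs where

open import Data.Nat using (ℕ; suc)
open import Data.Fin using (Fin; zero; suc)
open import Data.Bool using (Bool; true; false)
open import Data.Product using (Σ; _×_; ∃)
open import Relation.Binary.PropositionalEquality using (_≡_; _≢_)
open import Relation.Nullary using (¬_)
open import Function.Definitions using (Injective)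

record Graph (n : ℕ) : Set where
  field
    adj   : Fin n → Fin n → Bool
    sym   : ∀ x y → adj x y ≡ adj y x
    irrefl : ∀ x → adj x x ≡ false
open Graph public

record InducedEmbedding {m n : ℕ} (H : Graph m) (G : Graph n) : Set where
  field
    f     : Fin m → Fin n
    inj   : Injective _≡_ _≡_ f
    pres  : ∀ x y → adj G (f x) (f y) ≡ adj H x y

Free : {m n : ℕ} → Graph m → Graph n → Set
Free H G = ¬ InducedEmbedding H G

HasClique : {n : ℕ} → Graph n → ℕ → Set
HasClique {n} G k =
  Σ (Fin k → Fin n) λ f → Injective _≡_ _≡_ f × (∀ i j → i ≢ j → adj G (f i) (f j) ≡ true)

CliqueNumber : {n : ℕ} → Graph n → ℕ → Set
CliqueNumber G k = HasClique G k × ¬ HasClique G (suc k)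

Colorable : {n : ℕ} → Graph n → ℕ → Set
Colorable {n} G c =
  Σ (Fin n → Fin c) λ col → ∀ x y → adj G x y ≡ true → col x ≢ col y

-- P3 ∪ P2 on vertices 0-1-2 (path) and 3-4 (edge)
p3p2-adj : Fin 5 → Fin 5 → Bool
p3p2-adj zero (suc zero) = true
p3p2-adj (suc zero) zero = true
p3p2-adj (suc zero) (suc (suc zero)) = true
p3p2-adj (suc (suc zero)) (suc zero) = true
p3p2-adj (suc (suc (suc zero))) (suc (suc (suc (suc zero)))) = true
p3p2-adj (suc (suc (suc (suc zero)))) (suc (suc (suc zero))) = true
p3p2-adj _ _ = false

P3∪P2 : Graph 5
P3∪P2 = record
  { adj = p3p2-adj
  ; sym = λ { zero zero → _≡_.refl ; zero (suc zero) → _≡_.refl ; zero (suc (suc zero)) → _≡_.refl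
            ; zero (suc (suc (suc zero))) → _≡_.refl ; zero (suc (suc (suc (suc zero)))) → _≡_.refl
            ; (suc zero) zero → _≡_.refl ; (suc zero) (suc zero) → _≡_.refl ; (suc zero) (suc (suc zero)) → _≡_.refl
            ; (suc zero) (suc (suc (suc zero))) → _≡_.refl ; (suc zero) (suc (suc (suc (suc zero)))) → _≡_.refl
            ; (suc (suc zero)) zero → _≡_.refl ; (suc (suc zero)) (suc zero) → _≡_.refl ; (suc (suc zero)) (suc (suc zero)) → _≡_.refl
            ; (suc (suc zero)) (suc (suc (suc zero))) → _≡_.refl ; (suc (suc zero)) (suc (suc (suc (suc zero)))) → _≡_.refl
            ; (suc (suc (suc zero))) zero → _≡_.refl ; (suc (suc (suc zero))) (suc zero) → _≡_.refl ; (suc (suc (suc zero))) (suc (suc zero)) → _≡_.refl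
            ; (suc (suc (suc zero))) (suc (suc (suc zero))) → _≡_.refl ; (suc (suc (suc zero))) (suc (suc (suc (suc zero)))) → _≡_.refl
            ; (suc (suc (suc (suc zero)))) zero → _≡_.refl ; (suc (suc (suc (suc zero)))) (suc zero) → _≡_.refl ; (suc (suc (suc (suc zero)))) (suc (suc zero)) → _≡_.refl
            ; (suc (suc (suc (suc zero)))) (suc (suc (suc zero))) → _≡_.refl ; (suc (suc (suc (suc zero)))) (suc (suc (suc (suc zero)))) → _≡_.refl }
  ; irrefl = λ { zero → _≡_.refl ; (suc zero) → _≡_.refl ; (suc (suc zero)) → _≡_.refl
               ; (suc (suc (suc zero))) → _≡_.refl ; (suc (suc (suc (suc zero)))) → _≡_.refl }
  }

-- HVN = (K1 ∪ K2) + K2 : vertices 0,1,2,3 form a K4 and vertex 4 is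
-- adjacent exactly to 0 and 1.  (K2 = {0,1} joined to K1 ∪ K2 = {4} ∪ {2,3}.)
hvn-adj : Fin 5 → Fin 5 → Bool
hvn-adj zero zero = false
hvn-adj (suc zero) (suc zero) = false
hvn-adj (suc (suc zero)) (suc (suc zero)) = false
hvn-adj (suc (suc (suc zero))) (suc (suc (suc zero))) = false
hvn-adj (suc (suc (suc (suc zero)))) (suc (suc (suc (suc zero)))) = false
hvn-adj (suc (suc (suc (suc zero)))) (suc (suc zero)) = false
hvn-adj (suc (suc (suc (suc zero)))) (suc (suc (suc zero))) = false
hvn-adj (suc (suc zero)) (suc (suc (suc (suc zero)))) = false
hvn-adj (suc (suc (suc zero))) (suc (suc (suc (suc zero)))) = false
hvn-adj _ _ = true

HVN : Graph 5
HVN = record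
  { adj = hvn-adj
  ; sym = λ { zero zero → _≡_.refl ; zero (suc zero) → _≡_.refl ; zero (suc (suc zero)) → _≡_.refl
            ; zero (suc (suc (suc zero))) → _≡_.refl ; zero (suc (suc (suc (suc zero)))) → _≡_.refl
            ; (suc zero) zero → _≡_.refl ; (suc zero) (suc zero) → _≡_.refl ; (suc zero) (suc (suc zero)) → _≡_.refl
            ; (suc zero) (suc (suc (suc zero))) → _≡_.refl ; (suc zero) (suc (suc (suc (suc zero)))) → _≡_.refl
            ; (suc (suc zero)) zero → _≡_.refl ; (suc (suc zero)) (suc zero) → _≡_.refl ; (suc (suc zero)) (suc (suc zero)) → _≡_.refl
            ; (suc (suc zero)) (suc (suc (suc zero))) → _≡_.refl ; (suc (suc zero)) (suc (suc (suc (suc zero)))) → _≡_.refl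
            ; (suc (suc (suc zero))) zero → _≡_.refl ; (suc (suc (suc zero))) (suc zero) → _≡_.refl ; (suc (suc (suc zero))) (suc (suc zero)) → _≡_.refl
            ; (suc (suc (suc zero))) (suc (suc (suc zero))) → _≡_.refl ; (suc (suc (suc zero))) (suc (suc (suc (suc zero)))) → _≡_.refl
            ; (suc (suc (suc (suc zero)))) zero → _≡_.refl ; (suc (suc (suc (suc zero)))) (suc zero) → _≡_.refl ; (suc (suc (suc (suc zero)))) (suc (suc zero)) → _≡_.refl
            ; (suc (suc (suc (suc zero)))) (suc (suc (suc zero))) → _≡_.refl ; (suc (suc (suc (suc zero)))) (suc (suc (suc (suc zero)))) → _≡_.refl }
  ; irrefl = λ { zero → _≡_.refl ; (suc zero) → _≡_.refl ; (suc (suc zero)) → _≡_.refl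
               ; (suc (suc (suc zero))) → _≡_.refl ; (suc (suc (suc (suc zero)))) → _≡_.refl }
  }

{-# OPTIONS --safe #-}
-- Fix a maximum clique A.  A vertex whose only non-neighbour in A is A i gets colour i; two such
-- vertices are non-adjacent, since otherwise both together could replace A i in A.  Every other
-- vertex is far: it misses two vertices of A, so by HVN-freeness it has at most one neighbour in A,
-- its anchor, and all its neighbours that are not far carry the same colour.  The far vertices are
-- then coloured greedily with ω + 1 colours, along any order in which each far vertex has fewer
-- than ω earlier far neighbours.
--
-- By P3∪P2-freeness the vertices of an induced P3 of far vertices have three distinct anchors, as
-- otherwise two adjacent vertices of A miss the whole P3.  For ω ≥ 5 even three anchors leave two
-- such vertices, so the far neighbours of a far vertex form a clique.  For ω = 4 call a far vertex
-- crowded if it has four far neighbours; an analysis of anchors (HVN, K₅ and pigeonhole in Fin 4)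
-- shows that no far vertex has four crowded far neighbours, so listing crowded vertices first works.
module Submission where

open import Defs
open import Data.Bool using (true; false)
open import Data.Bool.Properties using (¬-not) renaming (_≟_ to _≟ᵇ_)
open import Data.Empty using (⊥; ⊥-elim)
open import Data.Fin using (Fin; zero; suc; toℕ; inject₁; inject≤; punchIn)
open import Data.Fin.Properties
  using (_≟_; any?; all?; pigeonhole; suc-injective; 0≢1+n; toℕ-injective; toℕ<n; inject₁-injective;
         inject≤-injective; punchIn-injective; punchInᵢ≢i; <⇒≢; <⇒notInjective)
open import Data.Nat using (ℕ; zero; suc; _+_; _≤_; _<_; _<?_)
open import Data.Nat.Properties
  using (≤-refl; <-irrefl; <-trans; <-≤-trans; ≤-<-trans; n<1+n; m≤m+n; +-monoʳ-<; +-cancelˡ-≡;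
         m<1+n⇒m<n∨m≡n; m≤n⇒m<n∨m≡n)
  renaming (_≟_ to _≟ℕ_)
open import Data.Product using (Σ; ∃; ∃₂; _×_; _,_; proj₁; proj₂)
open import Data.Sum using (_⊎_; inj₁; inj₂)
open import Data.Unit using (⊤; tt)
open import Data.Vec.Functional using ([]; _∷_; updateAt)
open import Data.Vec.Functional.Properties using (updateAt-updates; updateAt-minimal)
open import Function using (_∘_; case_of_)
open import Function.Definitions using (Injective)
open import Relation.Binary.PropositionalEquality as ≡ using (_≡_; _≢_; refl; trans; cong; subst; subst₂)
open import Relation.Nullary using (¬_; Dec; yes; no)
open import Relation.Nullary.Decidable using (_×-dec_; _⊎-dec_; _→-dec_; ¬?; map′; from-yes; decidable-stable)
open import Relation.Unary using (Decidable)

record AtLeast {n} (k : ℕ) (Q : Fin n → Set) : Set where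
  constructor atLeast
  field
    members   : Fin k → Fin n
    injective : Injective _≡_ _≡_ members
    satisfy   : ∀ i → Q (members i)

module _ {n : ℕ} where

  fresh-∷-injective : ∀ {k x} {g : Fin k → Fin n} →
                      (∀ i → g i ≢ x) → Injective _≡_ _≡_ g → Injective _≡_ _≡_ (x ∷ g)
  fresh-∷-injective x∉g g-inj {zero}  {zero}  _  = refl
  fresh-∷-injective x∉g g-inj {zero}  {suc j} eq = ⊥-elim (x∉g j (≡.sym eq))
  fresh-∷-injective x∉g g-inj {suc i} {zero}  eq = ⊥-elim (x∉g i eq)
  fresh-∷-injective x∉g g-inj {suc i} {suc j} eq = cong suc (g-inj eq)

  atLeast-map : ∀ {k} {P Q : Fin n → Set} → (∀ {x} → P x → Q x) → AtLeast k P → AtLeast k Q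
  atLeast-map P⇒Q (atLeast g g-inj P-g) = atLeast g g-inj (P⇒Q ∘ P-g)

  atLeast-≤ : ∀ {k m} {Q : Fin n → Set} → k ≤ m → AtLeast m Q → AtLeast k Q
  atLeast-≤ k≤m (atLeast g g-inj Q-g) =
    atLeast (λ i → g (inject≤ i k≤m)) (λ eq → inject≤-injective k≤m k≤m _ _ (g-inj eq)) (λ i → Q-g (inject≤ i k≤m))

  atLeast-remove : ∀ {k} {Q : Fin n → Set} → AtLeast (suc k) Q → ∀ x → AtLeast k (λ y → Q y × y ≢ x)
  atLeast-remove (atLeast g g-inj Q-g) x with any? (λ j → g j ≟ x)
  ... | yes (j , gj≡x) =
    atLeast (g ∘ punchIn j) (λ eq → punchIn-injective j _ _ (g-inj eq))
      λ i → Q-g (punchIn j i) , λ eq → punchInᵢ≢i j i (g-inj (trans eq (≡.sym gj≡x)))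
  ... | no x∉g = atLeast (g ∘ suc) (λ eq → suc-injective (g-inj eq)) λ i → Q-g (suc i) , λ eq → x∉g (suc i , eq)

  atLeast-two : ∀ {Q : Fin n → Set} {x y} → x ≢ y → Q x → Q y → AtLeast 2 Q
  atLeast-two {x = x} {y} x≢y Qx Qy =
    atLeast (x ∷ y ∷ [])
      (fresh-∷-injective (λ { zero → x≢y ∘ ≡.sym ; (suc ()) }) (fresh-∷-injective (λ ()) λ { {()} }))
      λ { zero → Qx ; (suc zero) → Qy }

  two-of : ∀ {Q : Fin n → Set} → AtLeast 2 Q → ∃₂ λ x y → x ≢ y × Q x × Q y
  two-of (atLeast g g-inj Q-g) = g zero , g (suc zero) , (λ eq → 0≢1+n (g-inj eq)) , Q-g zero , Q-g (suc zero)

  atLeast? : ∀ {Q : Fin n → Set} → Decidable Q → ∀ k → Dec (AtLeast k Q)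
  atLeast? Q? zero = yes (atLeast [] (λ { {()} }) λ ())
  atLeast? {Q} Q? (suc k) =
    map′ cons uncons (any? λ x → Q? x ×-dec atLeast? (λ y → Q? y ×-dec ¬? (y ≟ x)) k)
    where
    cons : ∃ (λ x → Q x × AtLeast k (λ y → Q y × y ≢ x)) → AtLeast (suc k) Q
    cons (x , Qx , atLeast g g-inj Q-g) =
      atLeast (x ∷ g) (fresh-∷-injective (proj₂ ∘ Q-g) g-inj) λ { zero → Qx ; (suc i) → proj₁ (Q-g i) }
    uncons : AtLeast (suc k) Q → ∃ λ x → Q x × AtLeast k (λ y → Q y × y ≢ x)
    uncons g@(atLeast f _ Q-f) = f zero , Q-f zero , atLeast-remove g (f zero)

outside-three-unique : ∀ {a b c x y : Fin 4} → a ≢ b → a ≢ c → b ≢ c →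
                       (x ≢ a × x ≢ b × x ≢ c) → (y ≢ a × y ≢ b × y ≢ c) → x ≡ y
outside-three-unique {a} {b} {c} {x} {y} a≢b a≢c b≢c (x≢a , x≢b , x≢c) (y≢a , y≢b , y≢c) =
  decidable-stable (x ≟ y) λ x≢y → <⇒notInjective (n<1+n 4) (five-distinct x≢y)
  where
  five-distinct : x ≢ y → Injective _≡_ _≡_ (a ∷ b ∷ c ∷ x ∷ y ∷ [])
  five-distinct x≢y =
    fresh-∷-injective (λ { zero → a≢b ∘ ≡.sym ; (suc zero) → a≢c ∘ ≡.sym ; (suc (suc zero)) → x≢a
                         ; (suc (suc (suc zero))) → y≢a ; (suc (suc (suc (suc ())))) })
    (fresh-∷-injective (λ { zero → b≢c ∘ ≡.sym ; (suc zero) → x≢b ; (suc (suc zero)) → y≢b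
                          ; (suc (suc (suc ()))) })
    (fresh-∷-injective (λ { zero → x≢c ; (suc zero) → y≢c ; (suc (suc ())) })
    (fresh-∷-injective (λ { zero → x≢y ∘ ≡.sym ; (suc ()) })
    (fresh-∷-injective (λ ()) λ { {()} }))))

map-avoiding-point-collides : ∀ {m} (a : Fin m) (f : Fin m → Fin m) → (∀ i → f i ≢ a) →
                              ∃₂ λ i j → i ≢ j × f i ≡ f j
map-avoiding-point-collides a f f≢a with pigeonhole (n<1+n _) (a ∷ f)
... | zero  , suc j , _   , a≡fj  = ⊥-elim (f≢a j (≡.sym a≡fj))
... | suc i , suc j , i<j , fi≡fj = i , j , (λ i≡j → <⇒≢ i<j (cong suc i≡j)) , fi≡fj
... | zero  , zero  , () , _
... | suc _ , zero  , () , _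

Twins : ∀ {m} → Graph m → Fin m → Fin m → Set
Twins H i j = ∀ k → adj H i k ≡ adj H j k

deleteVertex₀ : ∀ {m} → Graph (suc m) → Graph m
deleteVertex₀ H = record
  { adj = λ i j → adj H (suc i) (suc j)
  ; sym = λ i j → sym H (suc i) (suc j)
  ; irrefl = λ i → irrefl H (suc i)
  }

HVN-twin-free : ∀ {i j} → Twins HVN i j → i ≡ j
HVN-twin-free {i} {j} =
  from-yes (all? λ i → all? λ j → all? (λ k → adj HVN i k ≟ᵇ adj HVN j k) →-dec i ≟ j) i j

P3∪P2-twins : ∀ {i j} → i ≢ j → Twins P3∪P2 i j →
              (i ≡ zero × j ≡ suc (suc zero)) ⊎ (i ≡ suc (suc zero) × j ≡ zero)
P3∪P2-twins {i} {j} =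
  from-yes (all? λ i → all? λ j → ¬? (i ≟ j) →-dec all? (λ k → adj P3∪P2 i k ≟ᵇ adj P3∪P2 j k) →-dec
              ((i ≟ zero ×-dec j ≟ suc (suc zero)) ⊎-dec (i ≟ suc (suc zero) ×-dec j ≟ zero))) i j

module _ {n : ℕ} (G : Graph n) where

  infix 4 _∼_ _≁_ _∼?_ _≁?_

  _∼_ _≁_ : Fin n → Fin n → Set
  x ∼ y = adj G x y ≡ true
  x ≁ y = adj G x y ≡ false

  _∼?_ : ∀ x y → Dec (x ∼ y)
  x ∼? y = adj G x y ≟ᵇ true

  _≁?_ : ∀ x y → Dec (x ≁ y)
  x ≁? y = adj G x y ≟ᵇ false

  adj-sym : ∀ {x y b} → adj G x y ≡ b → adj G y x ≡ b
  adj-sym {x} {y} = trans (sym G y x)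

  ∼⇒¬≁ : ∀ {x y} → x ∼ y → ¬ x ≁ y
  ∼⇒¬≁ x∼y x≁y with () ← trans (≡.sym x∼y) x≁y

  ¬∼⇒≁ : ∀ {x y} → ¬ x ∼ y → x ≁ y
  ¬∼⇒≁ = ¬-not

  ¬≁⇒∼ : ∀ {x y} → ¬ x ≁ y → x ∼ y
  ¬≁⇒∼ = ¬-not

  ∼⇒≢ : ∀ {x y} → x ∼ y → x ≢ y
  ∼⇒≢ {x} x∼x refl = ∼⇒¬≁ x∼x (irrefl G x)

  IsClique : ∀ {k} → (Fin k → Fin n) → Set
  IsClique f = ∀ i j → i ≢ j → f i ∼ f j

  clique-injective : ∀ {k} {f : Fin k → Fin n} → IsClique f → Injective _≡_ _≡_ f
  clique-injective f-clique {i} {j} fi≡fj with i ≟ j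
  ... | yes i≡j = i≡j
  ... | no i≢j = ⊥-elim (∼⇒≢ (f-clique i j i≢j) fi≡fj)

  ∷-isClique : ∀ {k v} {f : Fin k → Fin n} → (∀ i → v ∼ f i) → IsClique f → IsClique (v ∷ f)
  ∷-isClique v∼f f-clique zero    zero    0≢0 = ⊥-elim (0≢0 refl)
  ∷-isClique v∼f f-clique zero    (suc j) _   = v∼f j
  ∷-isClique v∼f f-clique (suc i) zero    _   = adj-sym (v∼f i)
  ∷-isClique v∼f f-clique (suc i) (suc j) i≢j = f-clique i j (i≢j ∘ cong suc)

  updateAt-isClique : ∀ {k i w} {f : Fin k → Fin n} →
                      IsClique f → (∀ j → j ≢ i → w ∼ f j) → IsClique (updateAt f i λ _ → w)
  updateAt-isClique {i = i} {f = f} f-clique w∼f j j′ j≢j′ with j ≟ i | j′ ≟ i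
  ... | yes refl | yes refl = ⊥-elim (j≢j′ refl)
  ... | yes refl | no j′≢i =
    subst₂ _∼_ (≡.sym (updateAt-updates i f)) (≡.sym (updateAt-minimal j′ i f j′≢i)) (w∼f j′ j′≢i)
  ... | no j≢i | yes refl =
    subst₂ _∼_ (≡.sym (updateAt-minimal j i f j≢i)) (≡.sym (updateAt-updates i f)) (adj-sym (w∼f j j≢i))
  ... | no j≢i | no j′≢i =
    subst₂ _∼_ (≡.sym (updateAt-minimal j i f j≢i)) (≡.sym (updateAt-minimal j′ i f j′≢i)) (f-clique j j′ j≢j′)

  updateAt-adjacent : ∀ {k i v w} {f : Fin k → Fin n} →
                      v ∼ w → (∀ j → j ≢ i → v ∼ f j) → ∀ j → v ∼ updateAt f i (λ _ → w) j
  updateAt-adjacent {i = i} {f = f} v∼w v∼f j with j ≟ i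
  ... | yes refl = subst (_ ∼_) (≡.sym (updateAt-updates i f)) v∼w
  ... | no j≢i = subst (_ ∼_) (≡.sym (updateAt-minimal j i f j≢i)) (v∼f j j≢i)

  record Realises {m} (f : Fin m → Fin n) (H : Graph m) : Set where
    constructor realising
    field adj-≡ : ∀ i j → adj G (f i) (f j) ≡ adj H i j

  []-realises : ∀ {H : Graph 0} → Realises [] H
  []-realises = realising λ ()

  ∷-realises : ∀ {m v} {f : Fin m → Fin n} {H : Graph (suc m)} →
               (∀ j → adj G v (f j) ≡ adj H zero (suc j)) → Realises f (deleteVertex₀ H) → Realises (v ∷ f) H
  ∷-realises {v = v} {f} {H} row (realising rest) = realising realises
    where
    realises : ∀ i j → adj G ((v ∷ f) i) ((v ∷ f) j) ≡ adj H i j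
    realises zero    zero    = trans (irrefl G v) (≡.sym (irrefl H zero))
    realises zero    (suc j) = row j
    realises (suc i) zero    = trans (adj-sym (row i)) (sym H zero (suc i))
    realises (suc i) (suc j) = rest i j

  realises⇒embedding : ∀ {m} {f : Fin m → Fin n} {H : Graph m} →
                       Realises f H → (∀ {i j} → i ≢ j → Twins H i j → f i ≢ f j) → InducedEmbedding H G
  realises⇒embedding {f = f} {H} (realising realises) separated =
    record { f = f ; inj = injective ; pres = realises }
    where
    injective : Injective _≡_ _≡_ f
    injective {i} {j} fi≡fj with i ≟ j
    ... | yes i≡j = i≡j
    ... | no i≢j = ⊥-elim (separated i≢j twins fi≡fj)
      where
      twins : Twins H i j
      twins k = trans (≡.sym (realises i k)) (trans (cong (λ x → adj G x (f k)) fi≡fj) (realises j k))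

  no-P3∪P2 : Free P3∪P2 G → ∀ x₀ x₁ x₂ y₀ y₁ → x₀ ≢ x₂ →
             x₀ ∼ x₁ → x₁ ∼ x₂ → x₀ ≁ x₂ → y₀ ∼ y₁ →
             x₀ ≁ y₀ → x₀ ≁ y₁ → x₁ ≁ y₀ → x₁ ≁ y₁ → x₂ ≁ y₀ → x₂ ≁ y₁ → ⊥
  no-P3∪P2 free x₀ x₁ x₂ y₀ y₁ x₀≢x₂ x₀x₁ x₁x₂ x₀x₂ y₀y₁ x₀y₀ x₀y₁ x₁y₀ x₁y₁ x₂y₀ x₂y₁ =
    free (realises⇒embedding realises separated)
    where
    realises : Realises (x₀ ∷ x₁ ∷ x₂ ∷ y₀ ∷ y₁ ∷ []) P3∪P2
    realises =
      ∷-realises (λ { zero → x₀x₁ ; (suc zero) → x₀x₂ ; (suc (suc zero)) → x₀y₀ ; (suc (suc (suc zero))) → x₀y₁ })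
      (∷-realises (λ { zero → x₁x₂ ; (suc zero) → x₁y₀ ; (suc (suc zero)) → x₁y₁ })
      (∷-realises (λ { zero → x₂y₀ ; (suc zero) → x₂y₁ })
      (∷-realises (λ { zero → y₀y₁ ; (suc ()) })
      (∷-realises (λ ()) []-realises))))
    separated : ∀ {i j} → i ≢ j → Twins P3∪P2 i j →
                (x₀ ∷ x₁ ∷ x₂ ∷ y₀ ∷ y₁ ∷ []) i ≢ (x₀ ∷ x₁ ∷ x₂ ∷ y₀ ∷ y₁ ∷ []) j
    separated i≢j twins with P3∪P2-twins i≢j twins
    ... | inj₁ (refl , refl) = x₀≢x₂
    ... | inj₂ (refl , refl) = x₀≢x₂ ∘ ≡.sym

  no-HVN : Free HVN G → ∀ k₀ k₁ k₂ k₃ v →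
           k₀ ∼ k₁ → k₀ ∼ k₂ → k₀ ∼ k₃ → k₁ ∼ k₂ → k₁ ∼ k₃ → k₂ ∼ k₃ →
           k₀ ∼ v → k₁ ∼ v → k₂ ≁ v → k₃ ≁ v → ⊥
  no-HVN free k₀ k₁ k₂ k₃ v k₀k₁ k₀k₂ k₀k₃ k₁k₂ k₁k₃ k₂k₃ k₀v k₁v k₂v k₃v =
    free (realises⇒embedding realises (λ i≢j twins → ⊥-elim (i≢j (HVN-twin-free twins))))
    where
    realises : Realises (k₀ ∷ k₁ ∷ k₂ ∷ k₃ ∷ v ∷ []) HVN
    realises =
      ∷-realises (λ { zero → k₀k₁ ; (suc zero) → k₀k₂ ; (suc (suc zero)) → k₀k₃ ; (suc (suc (suc zero))) → k₀v })
      (∷-realises (λ { zero → k₁k₂ ; (suc zero) → k₁k₃ ; (suc (suc zero)) → k₁v })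
      (∷-realises (λ { zero → k₂k₃ ; (suc zero) → k₂v })
      (∷-realises (λ { zero → k₃v ; (suc ()) })
      (∷-realises (λ ()) []-realises))))

  module GreedyColouring
    (K : ℕ)
    {Z : Fin n → Set} (Z? : Decidable Z)
    {Forbidden : Fin n → Fin (suc K) → Set} (forbidden? : ∀ z → Decidable (Forbidden z))
    (forbidden-unique : ∀ {z c c′} → Z z → Forbidden z c → Forbidden z c′ → c ≡ c′)
    (rank : Fin n → ℕ) (rank-injective : Injective _≡_ _≡_ rank)
    (degenerate : ∀ {z} → Z z → ¬ AtLeast K (λ y → (Z y × z ∼ y) × rank y < rank z))
    where

    Colouring : Set
    Colouring = Fin n → Fin (suc K)

    GoodBelow : ℕ → Colouring → Set
    GoodBelow k col =
      (∀ {z} → Z z → rank z < k → ¬ Forbidden z (col z)) ×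
      (∀ {x y} → Z x → Z y → rank x < k → rank y < k → x ∼ y → col x ≢ col y)

    UsedBelow : ℕ → Colouring → Fin n → Fin (suc K) → Set
    UsedBelow k col z c = ∃ λ y → (Z y × z ∼ y) × rank y < k × col y ≡ c

    usedBelow? : ∀ k col z c → Dec (UsedBelow k col z c)
    usedBelow? k col z c = any? λ y → (Z? y ×-dec z ∼? y) ×-dec rank y <? k ×-dec col y ≟ c

    at-most-one-forbidden : ∀ {z} → Z z → ∃ λ c₀ → ∀ c → c ≢ c₀ → ¬ Forbidden z c
    at-most-one-forbidden {z} z∈Z with any? (forbidden? z)
    ... | yes (c₀ , forbidden-c₀) =
      c₀ , λ c c≢c₀ forbidden-c → c≢c₀ (forbidden-unique z∈Z forbidden-c forbidden-c₀)
    ... | no none-forbidden = zero , λ c _ forbidden-c → none-forbidden (c , forbidden-c)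

    available-colour : ∀ col {z} → Z z → ∃ λ c → ¬ Forbidden z c × ¬ UsedBelow (rank z) col z c
    available-colour col {z} z∈Z =
      decidable-stable (any? λ c → ¬? (forbidden? z c) ×-dec ¬? (usedBelow? (rank z) col z c))
        λ none → degenerate z∈Z (users λ c allowed →
          decidable-stable (usedBelow? (rank z) col z c) λ unused → none (c , allowed , unused))
      where
      users : (∀ c → ¬ Forbidden z c → UsedBelow (rank z) col z c) →
              AtLeast K (λ y → (Z y × z ∼ y) × rank y < rank z)
      users used = atLeast user user-injective user-earlier
        where
        c₀ : Fin (suc K)
        c₀ = proj₁ (at-most-one-forbidden z∈Z)
        used′ : ∀ i → UsedBelow (rank z) col z (punchIn c₀ i)
        used′ i = used (punchIn c₀ i) (proj₂ (at-most-one-forbidden z∈Z) _ (punchInᵢ≢i c₀ i))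
        user : Fin K → Fin n
        user i = proj₁ (used′ i)
        user-earlier : ∀ i → (Z (user i) × z ∼ user i) × rank (user i) < rank z
        user-earlier i = let _ , neighbour , earlier , _ = used′ i in neighbour , earlier
        user-colour : ∀ i → col (user i) ≡ punchIn c₀ i
        user-colour i = let _ , _ , _ , colour = used′ i in colour
        user-injective : Injective _≡_ _≡_ user
        user-injective {i} {j} eq =
          punchIn-injective c₀ i j (trans (≡.sym (user-colour i)) (trans (cong col eq) (user-colour j)))

    extend-at : ∀ {col z c} → GoodBelow (rank z) col → ¬ Forbidden z c → ¬ UsedBelow (rank z) col z c →
                GoodBelow (suc (rank z)) (updateAt col z λ _ → c)
    extend-at {col} {z} {c} (avoids , proper) allowed unused = avoids′ , proper′
      where
      col′ : Colouring
      col′ = updateAt col z λ _ → c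

      col′-z : col′ z ≡ c
      col′-z = updateAt-updates z col

      col′-other : ∀ {v} → v ≢ z → col′ v ≡ col v
      col′-other {v} v≢z = updateAt-minimal v z col v≢z

      below : ∀ {v} → rank v < suc (rank z) → v ≡ z ⊎ (v ≢ z × rank v < rank z)
      below r< with m<1+n⇒m<n∨m≡n r<
      ... | inj₂ rank≡ = inj₁ (rank-injective rank≡)
      ... | inj₁ rank< = inj₂ ((λ { refl → <-irrefl refl rank< }) , rank<)

      avoids′ : ∀ {v} → Z v → rank v < suc (rank z) → ¬ Forbidden v (col′ v)
      avoids′ v∈Z r< with below r<
      ... | inj₁ refl = subst (¬_ ∘ Forbidden z) (≡.sym col′-z) allowed
      ... | inj₂ (v≢z , rank<) = subst (¬_ ∘ Forbidden _) (≡.sym (col′-other v≢z)) (avoids v∈Z rank<)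

      proper′ : ∀ {x y} → Z x → Z y → rank x < suc (rank z) → rank y < suc (rank z) → x ∼ y → col′ x ≢ col′ y
      proper′ x∈Z y∈Z rx< ry< x∼y with below rx< | below ry<
      ... | inj₁ refl | inj₁ refl = ⊥-elim (∼⇒≢ x∼y refl)
      ... | inj₁ refl | inj₂ (y≢z , ry<) = λ eq →
        unused (_ , (y∈Z , x∼y) , ry< , trans (≡.sym (col′-other y≢z)) (trans (≡.sym eq) col′-z))
      ... | inj₂ (x≢z , rx<) | inj₁ refl = λ eq →
        unused (_ , (x∈Z , adj-sym x∼y) , rx< , trans (≡.sym (col′-other x≢z)) (trans eq col′-z))
      ... | inj₂ (x≢z , rx<) | inj₂ (y≢z , ry<) = λ eq →
        proper x∈Z y∈Z rx< ry< x∼y (trans (≡.sym (col′-other x≢z)) (trans eq (col′-other y≢z)))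

    extend-past : ∀ {k col} → GoodBelow k col → ¬ (∃ λ z → Z z × rank z ≡ k) → GoodBelow (suc k) col
    extend-past {k} (avoids , proper) none =
      (λ z∈Z r< → avoids z∈Z (below z∈Z r<)) , λ x∈Z y∈Z rx< ry< → proper x∈Z y∈Z (below x∈Z rx<) (below y∈Z ry<)
      where
      below : ∀ {v} → Z v → rank v < suc k → rank v < k
      below v∈Z r< with m<1+n⇒m<n∨m≡n r<
      ... | inj₁ rank< = rank<
      ... | inj₂ rank≡ = ⊥-elim (none (_ , v∈Z , rank≡))

    good-below : ∀ k → ∃ (GoodBelow k)
    good-below zero = (λ _ → zero) , (λ _ ()) , (λ _ _ ())
    good-below (suc k) with good-below k | any? (λ z → Z? z ×-dec rank z ≟ℕ k)
    ... | col , good | yes (z , z∈Z , refl) =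
      let c , allowed , unused = available-colour col z∈Z in _ , extend-at good allowed unused
    ... | col , good | no none = col , extend-past good none

    greedy-colouring : ∀ {B} → (∀ z → rank z < B) →
                       Σ Colouring λ col → (∀ {z} → Z z → ¬ Forbidden z (col z)) ×
                                           (∀ {x y} → Z x → Z y → x ∼ y → col x ≢ col y)
    greedy-colouring {B} rank<B with good-below B
    ... | col , avoids , proper =
      col , (λ z∈Z → avoids z∈Z (rank<B _)) , λ x∈Z y∈Z → proper x∈Z y∈Z (rank<B _) (rank<B _)

  module MaximumClique
    (P3∪P2-free : Free P3∪P2 G) (HVN-free : Free HVN G)
    {ω : ℕ} (4≤ω : 4 ≤ ω) {A : Fin ω → Fin n} (A-clique : IsClique A) (maximum : ¬ HasClique G (suc ω))
    where

    no-larger-clique : ∀ {f : Fin (suc ω) → Fin n} → IsClique f → ⊥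
    no-larger-clique f-clique = maximum (_ , clique-injective f-clique , f-clique)

    indices : AtLeast ω (λ _ → ⊤)
    indices = atLeast (λ i → i) (λ eq → eq) λ _ → tt

    index-avoiding₃ : ∀ p q r → ∃ λ e → e ≢ p × e ≢ q × e ≢ r
    index-avoiding₃ p q r = AtLeast.members avoiding zero , AtLeast.satisfy avoiding zero
      where
      avoiding : AtLeast 1 (λ e → e ≢ p × e ≢ q × e ≢ r)
      avoiding = atLeast-map (λ (((_ , e≢p) , e≢q) , e≢r) → e≢p , e≢q , e≢r)
                   (atLeast-remove (atLeast-remove (atLeast-remove (atLeast-≤ 4≤ω indices) p) q) r)

    indices-avoiding₂ : ∀ p q → AtLeast 2 (λ e → e ≢ p × e ≢ q)
    indices-avoiding₂ p q =
      atLeast-map (λ ((_ , e≢p) , e≢q) → e≢p , e≢q) (atLeast-remove (atLeast-remove (atLeast-≤ 4≤ω indices) p) q)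

    indices-avoiding₃ : 5 ≤ ω → ∀ p q r → AtLeast 2 (λ e → e ≢ p × e ≢ q × e ≢ r)
    indices-avoiding₃ 5≤ω p q r =
      atLeast-map (λ (((_ , e≢p) , e≢q) , e≢r) → e≢p , e≢q , e≢r)
        (atLeast-remove (atLeast-remove (atLeast-remove (atLeast-≤ 5≤ω indices) p) q) r)

    index-≢ : ∀ {v i j} → v ∼ A i → v ≁ A j → i ≢ j
    index-≢ v∼Ai v≁Aj refl = ∼⇒¬≁ v∼Ai v≁Aj

    -- Satisfied by A i itself, so the vertices of A need no separate colour class.
    MissesOnly : Fin n → Fin ω → Set
    MissesOnly v i = v ≁ A i × (∀ j → j ≢ i → v ∼ A j)

    missesOnly? : ∀ v i → Dec (MissesOnly v i)
    missesOnly? v i = v ≁? A i ×-dec all? λ j → ¬? (j ≟ i) →-dec v ∼? A j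

    Far : Fin n → Set
    Far v = AtLeast 2 (λ i → v ≁ A i)

    far? : Decidable Far
    far? v = atLeast? (λ i → v ≁? A i) 2

    FarNeighbour : Fin n → Fin n → Set
    FarNeighbour z y = Far y × z ∼ y

    misses-some : ∀ v → ∃ λ i → v ≁ A i
    misses-some v = decidable-stable (any? λ i → v ≁? A i) λ none →
      no-larger-clique (∷-isClique (λ i → ¬≁⇒∼ λ v≁Ai → none (i , v≁Ai)) A-clique)

    classify : ∀ v → (∃ λ i → MissesOnly v i) ⊎ Far v
    classify v with far? v | misses-some v
    ... | yes far-v | _ = inj₂ far-v
    ... | no ¬far | i , v≁Ai = inj₁ (i , v≁Ai , λ j j≢i → ¬≁⇒∼ λ v≁Aj → ¬far (atLeast-two j≢i v≁Aj v≁Ai))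

    missesOnly-independent : ∀ {u w i} → MissesOnly u i → MissesOnly w i → u ≁ w
    missesOnly-independent (_ , u∼A) (_ , w∼A) = ¬∼⇒≁ λ u∼w →
      no-larger-clique (∷-isClique (updateAt-adjacent u∼w u∼A) (updateAt-isClique A-clique w∼A))

    far-A-neighbour-unique : ∀ {z i j} → Far z → z ∼ A i → z ∼ A j → i ≡ j
    far-A-neighbour-unique {z} {i} {j} far-z z∼Ai z∼Aj with i ≟ j | two-of far-z
    ... | yes i≡j | _ = i≡j
    ... | no i≢j | k , l , k≢l , z≁Ak , z≁Al = ⊥-elim (no-HVN HVN-free (A i) (A j) (A k) (A l) z
      (A-clique _ _ i≢j) (A-clique _ _ (index-≢ z∼Ai z≁Ak)) (A-clique _ _ (index-≢ z∼Ai z≁Al))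
      (A-clique _ _ (index-≢ z∼Aj z≁Ak)) (A-clique _ _ (index-≢ z∼Aj z≁Al)) (A-clique _ _ k≢l)
      (adj-sym z∼Ai) (adj-sym z∼Aj) (adj-sym z≁Ak) (adj-sym z≁Al))

    far-∉A : ∀ {v i} → Far v → v ≢ A i
    far-∉A {i = i} far-v refl with two-of far-v
    ... | k , l , k≢l , Ai≁Ak , Ai≁Al =
      k≢l (trans (A-misses-only-itself Ai≁Ak) (≡.sym (A-misses-only-itself Ai≁Al)))
      where
      A-misses-only-itself : ∀ {j} → A i ≁ A j → j ≡ i
      A-misses-only-itself Ai≁Aj = decidable-stable (_ ≟ i) λ j≢i → ∼⇒¬≁ (A-clique _ _ (j≢i ∘ ≡.sym)) Ai≁Aj

    -- The unique neighbour of a far vertex in A, if it has one; otherwise a junk index.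
    anchor : Fin n → Fin ω
    anchor z with any? (λ i → z ∼? A i)
    ... | yes (i , _) = i
    ... | no _ = inject≤ zero 4≤ω

    Anchored : Fin n → Set
    Anchored z = z ∼ A (anchor z)

    anchor-unique : ∀ {z i} → Far z → z ∼ A i → i ≡ anchor z
    anchor-unique {z} far-z z∼Ai with any? (λ i → z ∼? A i)
    ... | yes (j , z∼Aj) = far-A-neighbour-unique far-z z∼Ai z∼Aj
    ... | no none = ⊥-elim (none (_ , z∼Ai))

    off-anchor : ∀ {z i} → Far z → i ≢ anchor z → z ≁ A i
    off-anchor far-z i≢anchor = ¬∼⇒≁ (i≢anchor ∘ anchor-unique far-z)

    unanchored : ∀ {z i} → Far z → ¬ Anchored z → z ≁ A i
    unanchored far-z ¬anchored = ¬∼⇒≁ λ z∼Ai → ¬anchored (subst (λ j → _ ∼ A j) (anchor-unique far-z z∼Ai) z∼Ai)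

    anchored-at : ∀ {z i} → Anchored z → anchor z ≡ i → z ∼ A i
    anchored-at anchored refl = anchored

    index-is-anchor : ∀ {z q w i} → Far z → z ∼ A q → z ∼ w → MissesOnly w i → i ≡ q
    index-is-anchor {z} {q} {w} {i} far-z z∼Aq z∼w (_ , w∼A) = decidable-stable (i ≟ q) λ i≢q →
      let k , l , k≢l , (k≢q , k≢i) , (l≢q , l≢i) = two-of (indices-avoiding₂ q i) in
      no-HVN HVN-free w (A q) (A k) (A l) z
        (w∼A q (i≢q ∘ ≡.sym)) (w∼A k k≢i) (w∼A l l≢i)
        (A-clique _ _ (k≢q ∘ ≡.sym)) (A-clique _ _ (l≢q ∘ ≡.sym)) (A-clique _ _ k≢l)
        (adj-sym z∼w) (adj-sym z∼Aq) (adj-sym (besides-anchor k≢q)) (adj-sym (besides-anchor l≢q))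
      where
      besides-anchor : ∀ {e} → e ≢ q → z ≁ A e
      besides-anchor e≢q = ¬∼⇒≁ λ z∼Ae → e≢q (far-A-neighbour-unique far-z z∼Ae z∼Aq)

    unanchored-sees-one-index : ∀ {z w w′ i i′} → (∀ e → z ≁ A e) →
                                z ∼ w → MissesOnly w i → z ∼ w′ → MissesOnly w′ i′ → i ≡ i′
    unanchored-sees-one-index {z} {w} {w′} {i} {i′} z≁A z∼w (_ , w∼A) z∼w′ (w′≁Ai′ , w′∼A) =
      decidable-stable (i ≟ i′) λ i≢i′ →
      let k , l , k≢l , (k≢i , k≢i′) , (l≢i , l≢i′) = two-of (indices-avoiding₂ i i′) in
      case w ∼? w′ of λ where
        (yes w∼w′) → no-HVN HVN-free w w′ (A k) (A l) z
          w∼w′ (w∼A k k≢i) (w∼A l l≢i) (w′∼A k k≢i′) (w′∼A l l≢i′) (A-clique _ _ k≢l)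
          (adj-sym z∼w) (adj-sym z∼w′) (adj-sym (z≁A k)) (adj-sym (z≁A l))
        (no w≭w′) → no-HVN HVN-free (A k) (A l) w (A i′) w′
          (A-clique _ _ k≢l) (adj-sym (w∼A k k≢i)) (A-clique _ _ k≢i′)
          (adj-sym (w∼A l l≢i)) (A-clique _ _ l≢i′) (w∼A i′ (i≢i′ ∘ ≡.sym))
          (adj-sym (w′∼A k k≢i′)) (adj-sym (w′∼A l l≢i′)) (¬∼⇒≁ w≭w′) (adj-sym w′≁Ai′)

    far-sees-one-index : ∀ {z w w′ i i′} → Far z → z ∼ w → MissesOnly w i → z ∼ w′ → MissesOnly w′ i′ → i ≡ i′
    far-sees-one-index {z} far-z z∼w w-i z∼w′ w′-i′ with any? (λ q → z ∼? A q)
    ... | yes (q , z∼Aq) =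
      trans (index-is-anchor far-z z∼Aq z∼w w-i) (≡.sym (index-is-anchor far-z z∼Aq z∼w′ w′-i′))
    ... | no none = unanchored-sees-one-index (λ e → ¬∼⇒≁ λ z∼Ae → none (e , z∼Ae)) z∼w w-i z∼w′ w′-i′

    Forbidden : Fin n → Fin (suc ω) → Set
    Forbidden z c = ∃₂ λ w i → z ∼ w × MissesOnly w i × inject₁ i ≡ c

    forbidden? : ∀ z → Decidable (Forbidden z)
    forbidden? z c = any? λ w → any? λ i → z ∼? w ×-dec missesOnly? w i ×-dec inject₁ i ≟ c

    forbidden-unique : ∀ {z c c′} → Far z → Forbidden z c → Forbidden z c′ → c ≡ c′
    forbidden-unique far-z (_ , _ , z∼w , w-i , refl) (_ , _ , z∼w′ , w′-i′ , refl) =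
      cong inject₁ (far-sees-one-index far-z z∼w w-i z∼w′ w′-i′)

    colourable-if-far-degenerate :
      (rank : Fin n → ℕ) → Injective _≡_ _≡_ rank → ∀ {B} → (∀ z → rank z < B) →
      (∀ {z} → Far z → ¬ AtLeast ω (λ y → FarNeighbour z y × rank y < rank z)) → Colorable G (suc ω)
    colourable-if-far-degenerate rank rank-injective rank<B degenerate =
      colour , λ x y x∼y → proper x∼y (classify x) (classify y)
      where
      open GreedyColouring ω far? forbidden? forbidden-unique rank rank-injective degenerate

      greedy : Colouring
      greedy = proj₁ (greedy-colouring rank<B)

      greedy-avoids : ∀ {z} → Far z → ¬ Forbidden z (greedy z)
      greedy-avoids = proj₁ (proj₂ (greedy-colouring rank<B))

      greedy-proper : ∀ {x y} → Far x → Far y → x ∼ y → greedy x ≢ greedy y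
      greedy-proper = proj₂ (proj₂ (greedy-colouring rank<B))

      colour-by : ∀ {v} → (∃ λ i → MissesOnly v i) ⊎ Far v → Fin (suc ω)
      colour-by (inj₁ (i , _)) = inject₁ i
      colour-by {v} (inj₂ _) = greedy v

      colour : Fin n → Fin (suc ω)
      colour v = colour-by (classify v)

      proper : ∀ {x y} → x ∼ y → (cx : (∃ λ i → MissesOnly x i) ⊎ Far x) (cy : (∃ λ i → MissesOnly y i) ⊎ Far y) →
               colour-by cx ≢ colour-by cy
      proper x∼y (inj₁ (i , x-i)) (inj₁ (j , y-j)) eq =
        ∼⇒¬≁ x∼y (missesOnly-independent x-i (subst (MissesOnly _) (≡.sym (inject₁-injective eq)) y-j))
      proper x∼y (inj₁ (i , x-i)) (inj₂ far-y) eq = greedy-avoids far-y (_ , i , adj-sym x∼y , x-i , eq)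
      proper x∼y (inj₂ far-x) (inj₁ (j , y-j)) eq = greedy-avoids far-x (_ , j , x∼y , y-j , ≡.sym eq)
      proper x∼y (inj₂ far-x) (inj₂ far-y) = greedy-proper far-x far-y x∼y

    record DistinctAnchors (x m y : Fin n) : Set where
      field
        anchored₁  : Anchored x
        anchored₂  : Anchored m
        anchored₃  : Anchored y
        distinct₁₂ : anchor x ≢ anchor m
        distinct₂₃ : anchor m ≢ anchor y
        distinct₁₃ : anchor x ≢ anchor y

    open DistinctAnchors public

    module InducedFarP3
      {x m y} (far-x : Far x) (far-m : Far m) (far-y : Far y)
      (x≢y : x ≢ y) (x∼m : x ∼ m) (m∼y : m ∼ y) (x≁y : x ≁ y)
      where

      Unseen : Fin ω → Set
      Unseen e = x ≁ A e × m ≁ A e × y ≁ A e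

      no-two-unseen : ∀ {e e′} → e ≢ e′ → Unseen e → Unseen e′ → ⊥
      no-two-unseen {e} {e′} e≢e′ (x≁Ae , m≁Ae , y≁Ae) (x≁Ae′ , m≁Ae′ , y≁Ae′) =
        no-P3∪P2 P3∪P2-free x m y (A e) (A e′) x≢y x∼m m∼y x≁y (A-clique _ _ e≢e′) x≁Ae x≁Ae′ m≁Ae m≁Ae′ y≁Ae y≁Ae′

      sees-three-indices : ∀ q q′ → ¬ (∀ e → e ≢ q → e ≢ q′ → Unseen e)
      sees-three-indices q q′ unseen =
        let e , e′ , e≢e′ , (e≢q , e≢q′) , (e′≢q , e′≢q′) = two-of (indices-avoiding₂ q q′) in
        no-two-unseen e≢e′ (unseen e e≢q e≢q′) (unseen e′ e′≢q e′≢q′)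

      distinct-anchors : DistinctAnchors x m y
      distinct-anchors = record
        { anchored₁  = decidable-stable (x ∼? A (anchor x)) λ ¬anchored →
            sees-three-indices (anchor m) (anchor y) λ e e≢m e≢y →
              unanchored far-x ¬anchored , off-anchor far-m e≢m , off-anchor far-y e≢y
        ; anchored₂  = decidable-stable (m ∼? A (anchor m)) λ ¬anchored →
            sees-three-indices (anchor x) (anchor y) λ e e≢x e≢y →
              off-anchor far-x e≢x , unanchored far-m ¬anchored , off-anchor far-y e≢y
        ; anchored₃  = decidable-stable (y ∼? A (anchor y)) λ ¬anchored →
            sees-three-indices (anchor x) (anchor m) λ e e≢x e≢m →
              off-anchor far-x e≢x , off-anchor far-m e≢m , unanchored far-y ¬anchored
        ; distinct₁₂ = λ x≡m → sees-three-indices (anchor x) (anchor y) λ e e≢x e≢y →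
            off-anchor far-x e≢x , off-anchor far-m (≢-≡ e≢x x≡m) , off-anchor far-y e≢y
        ; distinct₂₃ = λ m≡y → sees-three-indices (anchor m) (anchor x) λ e e≢m e≢x →
            off-anchor far-x e≢x , off-anchor far-m e≢m , off-anchor far-y (≢-≡ e≢m m≡y)
        ; distinct₁₃ = λ x≡y → sees-three-indices (anchor x) (anchor m) λ e e≢x e≢m →
            off-anchor far-x e≢x , off-anchor far-m e≢m , off-anchor far-y (≢-≡ e≢x x≡y)
        }
        where
        ≢-≡ : ∀ {e a b : Fin ω} → e ≢ a → a ≡ b → e ≢ b
        ≢-≡ e≢a refl = e≢a

      impossible-if-5≤ω : 5 ≤ ω → ⊥
      impossible-if-5≤ω 5≤ω =
        let e , e′ , e≢e′ , (e≢x , e≢m , e≢y) , (e′≢x , e′≢m , e′≢y) =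
              two-of (indices-avoiding₃ 5≤ω (anchor x) (anchor m) (anchor y))
        in
        no-two-unseen e≢e′ (off-anchor far-x e≢x , off-anchor far-m e≢m , off-anchor far-y e≢y)
                           (off-anchor far-x e′≢x , off-anchor far-m e′≢m , off-anchor far-y e′≢y)

    far-P3-anchors : ∀ {x m y} → Far x → Far m → Far y → x ≢ y → x ∼ m → m ∼ y → x ≁ y → DistinctAnchors x m y
    far-P3-anchors = InducedFarP3.distinct-anchors

    far-neighbours-adjacent : ∀ {z x y} → Far z → FarNeighbour z x → FarNeighbour z y → x ≢ y →
                              ¬ DistinctAnchors x z y → x ∼ y
    far-neighbours-adjacent far-z (far-x , z∼x) (far-y , z∼y) x≢y ¬distinct = ¬≁⇒∼ λ x≁y →
      ¬distinct (far-P3-anchors far-x far-z far-y x≢y (adj-sym z∼x) z∼y x≁y)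

    no-far-edge-missed-by-anchored : ∀ {x u v} → Far x → Anchored x → Far u → Far v → u ∼ v → x ≁ u → x ≁ v →
                           anchor u ≢ anchor x → anchor v ≢ anchor x → ⊥
    no-far-edge-missed-by-anchored {x} {u} {v} far-x anchored-x far-u far-v u∼v x≁u x≁v u-off v-off =
      let e , e≢x , e≢u , e≢v = index-avoiding₃ (anchor x) (anchor u) (anchor v) in
      no-P3∪P2 P3∪P2-free x (A (anchor x)) (A e) u v
        (far-∉A far-x) anchored-x (A-clique _ _ (e≢x ∘ ≡.sym)) (off-anchor far-x e≢x) u∼v x≁u x≁v
        (adj-sym (off-anchor far-u (u-off ∘ ≡.sym))) (adj-sym (off-anchor far-v (v-off ∘ ≡.sym)))
        (adj-sym (off-anchor far-u e≢u)) (adj-sym (off-anchor far-v e≢v))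

    no-K4-with-anchor-pair : ∀ {a b x y q} → a ∼ b → a ∼ x → a ∼ y → b ∼ x → b ∼ y → x ∼ y →
                             a ∼ A q → b ∼ A q → Far x → Far y → q ≢ anchor x → q ≢ anchor y → ⊥
    no-K4-with-anchor-pair ab ax ay bx by xy a-q b-q far-x far-y q≢x q≢y =
      no-HVN HVN-free _ _ _ _ _ ab ax ay bx by xy a-q b-q (off-anchor far-x q≢x) (off-anchor far-y q≢y)

    far-neighbours-adjacent-if-5≤ω : 5 ≤ ω → ∀ {z x y} → Far z → FarNeighbour z x → FarNeighbour z y → x ≢ y →
                                     x ∼ y
    far-neighbours-adjacent-if-5≤ω 5≤ω far-z (far-x , z∼x) (far-y , z∼y) x≢y = ¬≁⇒∼ λ x≁y →
      InducedFarP3.impossible-if-5≤ω far-x far-z far-y x≢y (adj-sym z∼x) z∼y x≁y 5≤ω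

    colourable-if-5≤ω : 5 ≤ ω → Colorable G (suc ω)
    colourable-if-5≤ω 5≤ω = colourable-if-far-degenerate toℕ toℕ-injective toℕ<n few-far-neighbours
      where
      few-far-neighbours : ∀ {z} → Far z → ¬ AtLeast ω (λ y → FarNeighbour z y × toℕ y < toℕ z)
      few-far-neighbours far-z (atLeast g g-injective g-nbr) =
        no-larger-clique (∷-isClique (proj₂ ∘ proj₁ ∘ g-nbr) λ i j i≢j →
          far-neighbours-adjacent-if-5≤ω 5≤ω far-z (proj₁ (g-nbr i)) (proj₁ (g-nbr j)) (i≢j ∘ g-injective))

  module CliqueNumberFour
    (P3∪P2-free : Free P3∪P2 G) (HVN-free : Free HVN G)
    {A : Fin 4 → Fin n} (A-clique : IsClique A) (maximum : ¬ HasClique G 5)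
    where

    open MaximumClique P3∪P2-free HVN-free ≤-refl A-clique maximum

    no-K5 : ∀ {a b c d e} → a ∼ b → a ∼ c → a ∼ d → a ∼ e → b ∼ c → b ∼ d → b ∼ e → c ∼ d → c ∼ e → d ∼ e → ⊥
    no-K5 {e = e} ab ac ad ae bc bd be cd ce de = no-larger-clique
      (∷-isClique (λ { zero → ab ; (suc zero) → ac ; (suc (suc zero)) → ad ; (suc (suc (suc zero))) → ae
                    ; (suc (suc (suc (suc ())))) })
      (∷-isClique (λ { zero → bc ; (suc zero) → bd ; (suc (suc zero)) → be ; (suc (suc (suc ()))) })
      (∷-isClique (λ { zero → cd ; (suc zero) → ce ; (suc (suc ())) })
      (∷-isClique (λ { zero → de ; (suc ()) })
      (∷-isClique {v = e} {[]} (λ ()) λ ())))))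

    Crowded : Fin n → Set
    Crowded z = AtLeast 4 (FarNeighbour z)

    crowded? : Decidable Crowded
    crowded? z = atLeast? (λ y → far? y ×-dec z ∼? y) 4

    crowded⇒anchored : ∀ {z} → Far z → Crowded z → Anchored z
    crowded⇒anchored {z} far-z (atLeast g g-injective g-nbr) = decidable-stable (z ∼? A (anchor z)) λ ¬anchored →
      no-larger-clique (∷-isClique (proj₂ ∘ g-nbr) λ i j i≢j →
        far-neighbours-adjacent far-z (g-nbr i) (g-nbr j) (i≢j ∘ g-injective) (¬anchored ∘ anchored₂))

    record Triangle (c u v : Fin n) : Set where
      field
        far-c      : Far c
        anchored-c : Anchored c
        far-u      : Far u
        far-v      : Far v
        c∼u        : c ∼ u
        c∼v        : c ∼ v
        u∼v        : u ∼ v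
        anchored-u : Anchored u
        anchored-v : Anchored v
        u-off-c    : anchor u ≢ anchor c
        v-off-c    : anchor v ≢ anchor c

    swap : ∀ {c u v} → Triangle c u v → Triangle c v u
    swap t = record
      { far-c = far-c ; anchored-c = anchored-c ; far-u = far-v ; far-v = far-u
      ; c∼u = c∼v ; c∼v = c∼u ; u∼v = adj-sym u∼v
      ; anchored-u = anchored-v ; anchored-v = anchored-u ; u-off-c = v-off-c ; v-off-c = u-off-c
      }
      where open Triangle t

    NewAnchor : Fin n → Fin n → Fin n → Fin n → Set
    NewAnchor c u v w = anchor w ≢ anchor c × anchor w ≢ anchor u × anchor w ≢ anchor v

    data Attachment (u v w : Fin n) : Set where
      both   : w ∼ u → w ∼ v → Attachment u v w
      only-u : w ∼ u → w ≁ v → Attachment u v w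
      only-v : w ≁ u → w ∼ v → Attachment u v w

    module _ {c u v} (t : Triangle c u v) where
      open Triangle t

      sees-u-unless-v : ∀ {w} → FarNeighbour c w → w ≢ u → w ≢ v → w ≁ v → w ∼ u
      sees-u-unless-v (far-w , c∼w) w≢u w≢v w≁v = ¬≁⇒∼ λ w≁u →
        let R₁ = far-P3-anchors far-w far-c far-u w≢u (adj-sym c∼w) c∼u w≁u
            R₂ = far-P3-anchors far-w far-c far-v w≢v (adj-sym c∼w) c∼v w≁v
        in no-far-edge-missed-by-anchored far-w (anchored₁ R₁) far-u far-v u∼v w≁u w≁v
             (distinct₁₃ R₁ ∘ ≡.sym) (distinct₁₃ R₂ ∘ ≡.sym)

      attachment : ∀ {w} → FarNeighbour c w → w ≢ u → w ≢ v → Attachment u v w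
      attachment {w} c-w w≢u w≢v with w ∼? u | w ∼? v
      ... | yes w∼u | yes w∼v = both w∼u w∼v
      ... | yes w∼u | no w≭v  = only-u w∼u (¬∼⇒≁ w≭v)
      ... | no w≭u  | yes w∼v = only-v (¬∼⇒≁ w≭u) w∼v
      ... | no w≭u  | no w≭v  = ⊥-elim (w≭u (sees-u-unless-v c-w w≢u w≢v (¬∼⇒≁ w≭v)))

      only-u-anchors : ∀ {w} → Far w → w ≢ v → w ∼ u → w ≁ v → DistinctAnchors w u v
      only-u-anchors far-w w≢v w∼u w≁v = far-P3-anchors far-w far-u far-v w≢v w∼u u∼v w≁v

      only-u-new : ∀ {w} → FarNeighbour c w → w ≢ v → w ∼ u → w ≁ v → NewAnchor c u v w
      only-u-new {w} (far-w , c∼w) w≢v w∼u w≁v = distinct₁₂ R₂ , distinct₁₂ R₁ , distinct₁₃ R₁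
        where
        R₁ : DistinctAnchors w u v
        R₁ = only-u-anchors far-w w≢v w∼u w≁v
        R₂ : DistinctAnchors w c v
        R₂ = far-P3-anchors far-w far-c far-v w≢v (adj-sym c∼w) c∼v w≁v

      sees-both-new : ∀ {w} → FarNeighbour c w → Anchored w → w ∼ u → w ∼ v → anchor u ≢ anchor v →
                      NewAnchor c u v w
      sees-both-new (far-w , c∼w) anchored-w w∼u w∼v u≢v =
          (λ w≡c → no-K4-with-anchor-pair c∼w c∼u c∼v w∼u w∼v u∼v
                     anchored-c (anchored-at anchored-w w≡c) far-u far-v (u-off-c ∘ ≡.sym) (v-off-c ∘ ≡.sym))
        , (λ w≡u → no-K4-with-anchor-pair (adj-sym w∼u) (adj-sym c∼u) u∼v (adj-sym c∼w) w∼v c∼v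
                     anchored-u (anchored-at anchored-w w≡u) far-c far-v u-off-c u≢v)
        , (λ w≡v → no-K4-with-anchor-pair (adj-sym w∼v) (adj-sym c∼v) (adj-sym u∼v) (adj-sym c∼w) w∼u c∼u
                     anchored-v (anchored-at anchored-w w≡v) far-c far-u v-off-c (u≢v ∘ ≡.sym))

      sees-both-shares : ∀ {w} → FarNeighbour c w → w ∼ u → w ∼ v → anchor u ≡ anchor v → anchor w ≡ anchor u
      sees-both-shares {w} (far-w , c∼w) w∼u w∼v u≡v = decidable-stable (anchor w ≟ anchor u) λ w≢u →
        no-K4-with-anchor-pair u∼v (adj-sym c∼u) (adj-sym w∼u) (adj-sym c∼v) (adj-sym w∼v) c∼w
          anchored-u (anchored-at anchored-v (≡.sym u≡v)) far-c far-w u-off-c (w≢u ∘ ≡.sym)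

      -- If x ∼ v then y x v is an induced P3; otherwise x, like y, sees only u, and then x and y
      -- are the only vertices of the K₄ x y c u anchored at anchor x.
      next-to-only-u : ∀ {x y} → FarNeighbour c x → FarNeighbour c y → x ≢ u → x ≢ v → y ≢ v →
                       y ∼ u → y ≁ v → x ∼ y → (Anchored x → Anchored y → anchor x ≡ anchor y) → ⊥
      next-to-only-u {x} (far-x , c∼x) (far-y , c∼y) x≢u x≢v y≢v y∼u y≁v x∼y agree with x ∼? v
      ... | yes x∼v =
        let R = far-P3-anchors far-y far-x far-v y≢v (adj-sym x∼y) x∼v y≁v
        in distinct₁₂ R (≡.sym (agree (anchored₂ R) (anchored₁ (only-u-anchors far-y y≢v y∼u y≁v))))
      ... | no x≭v =
        let x∼u = sees-u-unless-v (far-x , c∼x) x≢u x≢v (¬∼⇒≁ x≭v)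
            anchored-x = anchored₁ (only-u-anchors far-x x≢v x∼u (¬∼⇒≁ x≭v))
            anchored-y = anchored₁ (only-u-anchors far-y y≢v y∼u y≁v)
            x-off-c , x-off-u , _ = only-u-new (far-x , c∼x) x≢v x∼u (¬∼⇒≁ x≭v)
        in no-K4-with-anchor-pair x∼y (adj-sym c∼x) x∼u (adj-sym c∼y) y∼u c∼u
             anchored-x (anchored-at anchored-y (≡.sym (agree anchored-x anchored-y))) far-c far-u x-off-c x-off-u

    swap-new : ∀ {c u v w} → NewAnchor c u v w → NewAnchor c v u w
    swap-new (w≢c , w≢u , w≢v) = w≢c , w≢v , w≢u

    module _ {c u v} (t : Triangle c u v) where
      open Triangle t

      anchor-shared : ∀ {w} → FarNeighbour c w → w ≢ u → w ≢ v → anchor u ≡ anchor v → anchor w ≡ anchor u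
      anchor-shared c-w w≢u w≢v u≡v with attachment t c-w w≢u w≢v
      ... | both w∼u w∼v = sees-both-shares t c-w w∼u w∼v u≡v
      ... | only-u w∼u w≁v = ⊥-elim (distinct₂₃ (only-u-anchors t (proj₁ c-w) w≢v w∼u w≁v) u≡v)
      ... | only-v w≁u w∼v = ⊥-elim (distinct₂₃ (only-u-anchors (swap t) (proj₁ c-w) w≢u w∼v w≁u) (≡.sym u≡v))

      anchor-new : ∀ {w} → FarNeighbour c w → w ≢ u → w ≢ v → Anchored w → anchor u ≢ anchor v → NewAnchor c u v w
      anchor-new c-w w≢u w≢v anchored-w u≢v with attachment t c-w w≢u w≢v
      ... | both w∼u w∼v = sees-both-new t c-w anchored-w w∼u w∼v u≢v
      ... | only-u w∼u w≁v = only-u-new t c-w w≢v w∼u w≁v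
      ... | only-v w≁u w∼v = swap-new (only-u-new (swap t) c-w w≢u w∼v w≁u)

      anchors-agree : ∀ {w w′} → FarNeighbour c w → FarNeighbour c w′ → w ≢ u → w ≢ v → w′ ≢ u → w′ ≢ v →
                      Anchored w → Anchored w′ → anchor w ≡ anchor w′
      anchors-agree c-w c-w′ w≢u w≢v w′≢u w′≢v anchored-w anchored-w′ with anchor u ≟ anchor v
      ... | yes u≡v = trans (anchor-shared c-w w≢u w≢v u≡v) (≡.sym (anchor-shared c-w′ w′≢u w′≢v u≡v))
      ... | no u≢v = outside-three-unique (u-off-c ∘ ≡.sym) (v-off-c ∘ ≡.sym) u≢v
                       (anchor-new c-w w≢u w≢v anchored-w u≢v) (anchor-new c-w′ w′≢u w′≢v anchored-w′ u≢v)

      no-two-more-neighbours : ∀ {w₃ w₄} → FarNeighbour c w₃ → FarNeighbour c w₄ → w₃ ≢ w₄ →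
                               w₃ ≢ u → w₃ ≢ v → w₄ ≢ u → w₄ ≢ v → ⊥
      no-two-more-neighbours {w₃} {w₄} c-w₃ c-w₄ w₃≢w₄ w₃≢u w₃≢v w₄≢u w₄≢v =
        by-adjacency (w₃ ∼? w₄) (anchors-agree c-w₃ c-w₄ w₃≢u w₃≢v w₄≢u w₄≢v)
        where
        by-adjacency : Dec (w₃ ∼ w₄) → (Anchored w₃ → Anchored w₄ → anchor w₃ ≡ anchor w₄) → ⊥
        by-adjacency (no w₃≭w₄) agree =
          let R = far-P3-anchors (proj₁ c-w₃) far-c (proj₁ c-w₄) w₃≢w₄ (adj-sym (proj₂ c-w₃)) (proj₂ c-w₄)
                                 (¬∼⇒≁ w₃≭w₄)
          in distinct₁₃ R (agree (anchored₁ R) (anchored₃ R))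
        by-adjacency (yes w₃∼w₄) agree with attachment t c-w₄ w₄≢u w₄≢v | attachment t c-w₃ w₃≢u w₃≢v
        ... | only-u w₄∼u w₄≁v | _ = next-to-only-u t c-w₃ c-w₄ w₃≢u w₃≢v w₄≢v w₄∼u w₄≁v w₃∼w₄ agree
        ... | only-v w₄≁u w₄∼v | _ = next-to-only-u (swap t) c-w₃ c-w₄ w₃≢v w₃≢u w₄≢u w₄∼v w₄≁u w₃∼w₄ agree
        ... | both _ _ | only-u w₃∼u w₃≁v =
          next-to-only-u t c-w₄ c-w₃ w₄≢u w₄≢v w₃≢v w₃∼u w₃≁v (adj-sym w₃∼w₄) λ a₄ a₃ → ≡.sym (agree a₃ a₄)
        ... | both _ _ | only-v w₃≁u w₃∼v =
          next-to-only-u (swap t) c-w₄ c-w₃ w₄≢v w₄≢u w₃≢u w₃∼v w₃≁u (adj-sym w₃∼w₄) λ a₄ a₃ → ≡.sym (agree a₃ a₄)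
        ... | both w₄∼u w₄∼v | both w₃∼u w₃∼v =
          no-K5 c∼u c∼v (proj₂ c-w₃) (proj₂ c-w₄) u∼v
                (adj-sym w₃∼u) (adj-sym w₄∼u) (adj-sym w₃∼v) (adj-sym w₄∼v) w₃∼w₄

      not-crowded : ¬ Crowded c
      not-crowded crowded =
        let w₃ , w₄ , w₃≢w₄ , ((c-w₃ , w₃≢u) , w₃≢v) , ((c-w₄ , w₄≢u) , w₄≢v) =
              two-of (atLeast-remove (atLeast-remove crowded u) v)
        in no-two-more-neighbours c-w₃ c-w₄ w₃≢w₄ w₃≢u w₃≢v w₄≢u w₄≢v

    module CrowdedStar
      {z} (far-z : Far z) {g : Fin 4 → Fin n} (g-injective : Injective _≡_ _≡_ g)
      (g-nbr : ∀ i → FarNeighbour z (g i)) (g-crowded : ∀ i → Crowded (g i))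
      where

      anchored-z : Anchored z
      anchored-z = crowded⇒anchored far-z (atLeast g g-injective g-nbr)

      anchored-g : ∀ i → Anchored (g i)
      anchored-g i = crowded⇒anchored (proj₁ (g-nbr i)) (g-crowded i)

      g-adjacent : ∀ {i j} → i ≢ j → ¬ DistinctAnchors (g i) z (g j) → g i ∼ g j
      g-adjacent {i} {j} i≢j = far-neighbours-adjacent far-z (g-nbr i) (g-nbr j) (i≢j ∘ g-injective)

      not-all-at-centre : ¬ (∀ i → anchor (g i) ≡ anchor z)
      not-all-at-centre at = no-larger-clique (∷-isClique (proj₂ ∘ g-nbr) λ i j i≢j →
        g-adjacent i≢j λ R → distinct₁₂ R (at i))

      not-off-and-at-centre : ∀ {i j} → anchor (g i) ≡ anchor z → anchor (g j) ≢ anchor z → ⊥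
      not-off-and-at-centre {i} {j} i-at j-off = not-crowded triangle (g-crowded j)
        where
        j≢i : j ≢ i
        j≢i refl = j-off i-at
        triangle : Triangle (g j) z (g i)
        triangle = record
          { far-c = proj₁ (g-nbr j) ; anchored-c = anchored-g j
          ; far-u = far-z ; far-v = proj₁ (g-nbr i)
          ; c∼u = adj-sym (proj₂ (g-nbr j)) ; c∼v = g-adjacent j≢i (λ R → distinct₂₃ R (≡.sym i-at))
          ; u∼v = proj₂ (g-nbr i)
          ; anchored-u = anchored-z ; anchored-v = anchored-g i
          ; u-off-c = j-off ∘ ≡.sym ; v-off-c = λ i≡j → j-off (trans (≡.sym i≡j) i-at)
          }

      not-all-off-centre : ¬ (∀ i → anchor (g i) ≢ anchor z)
      not-all-off-centre off =
        let i , i′ , i≢i′ , same = map-avoiding-point-collides (anchor z) (anchor ∘ g) off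
        in not-crowded (triangle i≢i′ same) (atLeast g g-injective g-nbr)
        where
        triangle : ∀ {i i′} → i ≢ i′ → anchor (g i) ≡ anchor (g i′) → Triangle z (g i) (g i′)
        triangle {i} {i′} i≢i′ same = record
          { far-c = far-z ; anchored-c = anchored-z
          ; far-u = proj₁ (g-nbr i) ; far-v = proj₁ (g-nbr i′) ; c∼u = proj₂ (g-nbr i) ; c∼v = proj₂ (g-nbr i′)
          ; u∼v = g-adjacent i≢i′ λ R → distinct₁₃ R same
          ; anchored-u = anchored-g i ; anchored-v = anchored-g i′
          ; u-off-c = off i ; v-off-c = off i′
          }

      impossible : ⊥
      impossible = by-anchors (any? λ j → ¬? (anchor (g j) ≟ anchor z)) (any? λ i → anchor (g i) ≟ anchor z)
        where
        by-anchors : Dec (∃ λ j → anchor (g j) ≢ anchor z) → Dec (∃ λ i → anchor (g i) ≡ anchor z) → ⊥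
        by-anchors (yes (j , j-off)) (yes (i , i-at)) = not-off-and-at-centre i-at j-off
        by-anchors (no none-off) _ =
          not-all-at-centre λ i → decidable-stable (anchor (g i) ≟ anchor z) λ off → none-off (i , off)
        by-anchors _ (no none-at) = not-all-off-centre λ i at → none-at (i , at)

    rank-by : ∀ {z} → Dec (Crowded z) → ℕ
    rank-by {z} (yes _) = toℕ z
    rank-by {z} (no _)  = n + toℕ z

    rank : Fin n → ℕ
    rank z = rank-by (crowded? z)

    rank-injective : Injective _≡_ _≡_ rank
    rank-injective {x} {y} = by-crowdedness (crowded? x) (crowded? y)
      where
      by-crowdedness : (dx : Dec (Crowded x)) (dy : Dec (Crowded y)) → rank-by dx ≡ rank-by dy → x ≡ y
      by-crowdedness (yes _) (yes _) eq = toℕ-injective eq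
      by-crowdedness (no _)  (no _)  eq = toℕ-injective (+-cancelˡ-≡ n _ _ eq)
      by-crowdedness (yes _) (no _)  eq = ⊥-elim (<-irrefl eq (<-≤-trans (toℕ<n x) (m≤m+n n (toℕ y))))
      by-crowdedness (no _)  (yes _) eq = ⊥-elim (<-irrefl (≡.sym eq) (<-≤-trans (toℕ<n y) (m≤m+n n (toℕ x))))

    rank<2n : ∀ z → rank z < n + n
    rank<2n z = by-crowdedness (crowded? z)
      where
      by-crowdedness : (d : Dec (Crowded z)) → rank-by d < n + n
      by-crowdedness (yes _) = <-≤-trans (toℕ<n z) (m≤m+n n n)
      by-crowdedness (no _)  = +-monoʳ-< n (toℕ<n z)

    earlier-than-crowded : ∀ {y z} → Crowded z → rank y < rank z → Crowded y
    earlier-than-crowded {y} {z} crowded-z = by-crowdedness (crowded? y) (crowded? z)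
      where
      by-crowdedness : (dy : Dec (Crowded y)) (dz : Dec (Crowded z)) → rank-by dy < rank-by dz → Crowded y
      by-crowdedness (yes crowded-y) _ _ = crowded-y
      by-crowdedness (no _) (yes _) earlier =
        ⊥-elim (<-irrefl refl (<-trans (≤-<-trans (m≤m+n n (toℕ y)) earlier) (toℕ<n z)))
      by-crowdedness (no _) (no ¬crowded-z) _ = ⊥-elim (¬crowded-z crowded-z)

    few-earlier-far-neighbours : ∀ {z} → Far z → ¬ AtLeast 4 (λ y → FarNeighbour z y × rank y < rank z)
    few-earlier-far-neighbours far-z earlier@(atLeast g g-injective g-earlier) =
      CrowdedStar.impossible far-z g-injective (proj₁ ∘ g-earlier) λ i →
        earlier-than-crowded (atLeast-map proj₁ earlier) (proj₂ (g-earlier i))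

    colourable : Colorable G 5
    colourable = colourable-if-far-degenerate rank rank-injective rank<2n few-earlier-far-neighbours

theorem3p6 : (n : ℕ) (G : Graph n) (ω : ℕ) →
    Free P3∪P2 G → Free HVN G → CliqueNumber G ω → 4 ≤ ω →
    Colorable G (suc ω)
theorem3p6 n G ω P3∪P2-free HVN-free ((A , _ , A-clique) , maximum) 4≤ω with m≤n⇒m<n∨m≡n 4≤ω
... | inj₁ 5≤ω = MaximumClique.colourable-if-5≤ω G P3∪P2-free HVN-free 4≤ω A-clique maximum 5≤ω
... | inj₂ refl = CliqueNumberFour.colourable G P3∪P2-free HVN-free A-clique maximum
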